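{- Let $(z_n)_{n\in\mathbb{N}}$ be a sequence of natural numbers such that there exists an integer $m\ge 1$ with $$z_{n+m+1}>\min\{z_{n+1},\dots,z_{n+m}\}\quad\text{for all sufficiently large } n.$$ Then $z_n\to\infty$ as $n\to\infty$. -}

module Defs where

open import Data.Nat using (ℕ; zero; suc; _+_; _⊓_; _≤_)
open import Data.Product using (∃-syntax)

-- minOver z n k = min { z (n + 1), …, z (n + (k + 1)) }  (a window of k+1 terms)
minOver : (ℕ → ℕ) → ℕ → ℕ → ℕ
minOver z n zero    = z (n + 1)
minOver z n (suc k) = minOver z n k ⊓ z (n + suc (suc k))

-- windowMin z n m = min { z (n+1), …, z (n+m) } for m ≥ 1
-- (for m = 0 it returns z (n+1); only used with m ≥ 1)
windowMin : (ℕ → ℕ) → ℕ → ℕ → ℕ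
windowMin z n zero    = z (n + 1)
windowMin z n (suc k) = minOver z n k

TendsToInfinity : (ℕ → ℕ) → Set
TendsToInfinity z = ∀ (B : ℕ) → ∃[ N ] (∀ n → N ≤ n → B ≤ z n)

{-# OPTIONS --safe #-}
-- Let W n be the minimum of the window z (n+1), …, z (n+m). Eventually W is
-- nondecreasing, since the term entering the window exceeds the old minimum;
-- hence every term after the window exceeds W n, so W (n+m) > W n. Thus W grows
-- at least linearly along steps of m, and W n bounds every z j with j > n.
module Submission where

open import Defs
open import Data.Nat using (ℕ; zero; suc; _+_; _*_; _<_; _≤_; _≤′_; ≤′-reflexive; ≤′-step; z≤n; s≤s; _≤?_)
open import Data.Nat.Properties
open import Data.Nat.Tactic.RingSolver using (solve-∀)
open import Data.Product using (∃-syntax; _×_; _,_)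
open import Relation.Nullary using (yes; no)
open import Relation.Binary.PropositionalEquality

stepwise-mono-≤ : {f : ℕ → ℕ} {N : ℕ} → (∀ n → N ≤ n → f n ≤ f (suc n)) →
                  ∀ {n p} → N ≤ n → n ≤ p → f n ≤ f p
stepwise-mono-≤ {f} {N} step {n} N≤n n≤p = go (≤⇒≤′ n≤p)
  where
  go : ∀ {p} → n ≤′ p → f n ≤ f p
  go (≤′-reflexive refl) = ≤-refl
  go (≤′-step {p} n≤′p)  = ≤-trans (go n≤′p) (step p (≤-trans N≤n (≤′⇒≤ n≤′p)))

periodic-increase⇒≥ : {f : ℕ → ℕ} {N m : ℕ} → (∀ n → N ≤ n → f n < f (n + m)) →
                      ∀ B → B ≤ f (N + B * m)
periodic-increase⇒≥ increase zero    = z≤n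
periodic-increase⇒≥ {f} {N} {m} increase (suc B) =
  subst (λ i → suc B ≤ f i) N+B*m+m≡N+[1+B]*m
    (≤-trans (s≤s (periodic-increase⇒≥ increase B)) (increase (N + B * m) (m≤m+n N _)))
  where
  N+B*m+m≡N+[1+B]*m : N + B * m + m ≡ N + suc B * m
  N+B*m+m≡N+[1+B]*m = trans (+-assoc N (B * m) m) (cong (N +_) (+-comm (B * m) m))

minOver-≤ : ∀ z n k {j} → n < j → j ≤ n + suc k → minOver z n k ≤ z j
minOver-≤ z n zero {j} n<j j≤n+1 =
  ≤-reflexive (cong z (≤-antisym (subst (_≤ j) (+-comm 1 n) n<j) j≤n+1))
minOver-≤ z n (suc k) {j} n<j j≤n+2+k with j ≤? n + suc k
... | yes j≤n+1+k = ≤-trans (m⊓n≤m _ _) (minOver-≤ z n k n<j j≤n+1+k)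
... | no  j≰n+1+k = ≤-trans (m⊓n≤n _ _) (≤-reflexive (cong z j≡n+2+k))
  where
  j≡n+2+k : n + suc (suc k) ≡ j
  j≡n+2+k = ≤-antisym (subst (_≤ j) (sym (+-suc n (suc k))) (≰⇒> j≰n+1+k)) j≤n+2+k

minOver-greatest : ∀ z n k {b} → (∀ {j} → n < j → j ≤ n + suc k → b ≤ z j) → b ≤ minOver z n k
minOver-greatest z n zero    bound = bound (m<m+n n (s≤s z≤n)) ≤-refl
minOver-greatest z n (suc k) bound =
  ⊓-glb (minOver-greatest z n k (λ n<j j≤n+1+k → bound n<j (≤-trans j≤n+1+k (+-monoʳ-≤ n (n≤1+n _)))))
        (bound (m<m+n n (s≤s z≤n)) ≤-refl)

module EventuallyExceedingWindowMin
  (z : ℕ → ℕ) (k N : ℕ)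
  (exceeds : ∀ n → N ≤ n → minOver z n k < z (n + suc k + 1))
  where

  W : ℕ → ℕ
  W n = minOver z n k

  W-step : ∀ n → N ≤ n → W n ≤ W (suc n)
  W-step n N≤n = minOver-greatest z (suc n) k bound
    where
    bound : ∀ {j} → suc n < j → j ≤ suc n + suc k → W n ≤ z j
    bound {j} 1+n<j j≤n+2+k with j ≤? n + suc k
    ... | yes j≤n+1+k = minOver-≤ z n k (<⇒≤ 1+n<j) j≤n+1+k
    ... | no  j≰n+1+k = <⇒≤ (subst (λ i → W n < z i) n+1+k+1≡j (exceeds n N≤n))
      where
      n+1+k+1≡j : n + suc k + 1 ≡ j
      n+1+k+1≡j = trans (+-comm _ 1) (≤-antisym (≰⇒> j≰n+1+k) j≤n+2+k)

  W-mono : ∀ {n p} → N ≤ n → n ≤ p → W n ≤ W p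
  W-mono = stepwise-mono-≤ W-step

  W<beyond-window : ∀ {n j} → N ≤ n → n + suc k < j → W n < z j
  W<beyond-window {n} {j} N≤n n+1+k<j = let d , j≡ = m≤n⇒∃[o]m+o≡n n+1+k<j in
    ≤-<-trans (W-mono N≤n (m≤m+n n d))
      (subst (λ i → W (n + d) < z i) (trans (shift n d k) j≡) (exceeds (n + d) (≤-trans N≤n (m≤m+n n d))))
    where
    shift : ∀ a d c → a + d + suc c + 1 ≡ suc (a + suc c) + d
    shift = solve-∀

  W≤later : ∀ {n j} → N ≤ n → n < j → W n ≤ z j
  W≤later {n} {j} N≤n n<j with j ≤? n + suc k
  ... | yes j≤n+1+k = minOver-≤ z n k n<j j≤n+1+k
  ... | no  j≰n+1+k = <⇒≤ (W<beyond-window N≤n (≰⇒> j≰n+1+k))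

  W-increase : ∀ n → N ≤ n → W n < W (n + suc k)
  W-increase n N≤n = minOver-greatest z (n + suc k) k (λ n+1+k<j _ → W<beyond-window N≤n n+1+k<j)

lemma3p2 : (z : ℕ → ℕ) →
    (∃[ m ] (1 ≤ m × ∃[ N ] (∀ n → N ≤ n → windowMin z n m < z (n + m + 1)))) →
    TendsToInfinity z
lemma3p2 z (suc k , _ , N , exceeds) B = suc (N + B * suc k) , λ j N+B*m<j →
  ≤-trans (periodic-increase⇒≥ W-increase B) (W≤later (m≤m+n N _) N+B*m<j)
  where open EventuallyExceedingWindowMin z k N exceeds
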